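{- Every connected cograph $G$ has a spanning even tree, unless $G$ is isomorphic to the balanced complete bipartite graph $K_{t,t}$ for some $t \ge 1$.
   Context: All graphs are finite and simple. Cographs are defined inductively: a single-vertex graph is a cograph; the disjoint union of two vertex-disjoint cographs is a cograph; and the complete join $G_1 \Join G_2$ of two vertex-disjoint cographs $G_1=(V_1,E_1)$, $G_2=(V_2,E_2)$, i.e. the graph on $V_1\cup V_2$ with edge set $E_1\cup E_2\cup\{\{u,v\}: u\in V_1, v\in V_2\}$, is a cograph. A leaf of a tree is a vertex of degree $1$. A tree is even if for every pair of distinct leaves, the number of edges of the unique path between them is even. A spanning even tree of $G$ is a spanning tree of $G$ that is even. -}

module Defs where

open import Data.Nat using (ℕ; zero; suc; _+_; _∸_)
open import Data.Nat.Properties using ()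
open import Data.Bool using (Bool; true; false; if_then_else_; T)
open import Data.Fin using (Fin; splitAt)
open import Data.Sum using (_⊎_; inj₁; inj₂)
open import Data.Product using (Σ; ∃; ∃-syntax; _×_; _,_)
open import Data.List using (List; []; _∷_; length; map; head; last)
open import Data.Nat.ListAction using (sum)
open import Data.List.Base using ()
open import Data.List.Relation.Unary.Unique.Propositional using (Unique)
open import Data.Maybe using (Maybe; just)
open import Data.Fin.Base using ()
open import Data.List using (allFin)
open import Data.Nat using (_≤_)
open import Relation.Binary.PropositionalEquality using (_≡_; refl)
open import Function.Bundles using (_↔_; Inverse)

record Graph (n : ℕ) : Set where
  field
    adj    : Fin n → Fin n → Bool
    sym    : ∀ u v → adj u v ≡ adj v u
    irrefl : ∀ v → adj v v ≡ false
open Graph public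

_∼[_]_ : ∀ {n} → Fin n → Graph n → Fin n → Set
u ∼[ G ] v = T (adj G u v)

record _≅_ {n m : ℕ} (G : Graph n) (H : Graph m) : Set where
  field
    bij      : Fin n ↔ Fin m
    preserve : ∀ u v → adj G u v ≡ adj H (Inverse.to bij u) (Inverse.to bij v)

-- Disjoint union (b = false) and complete join (b = true) of two graphs,
-- placing the vertices of G on Fin m ⊆ Fin (m + n) and those of H after.

private
  combAdj : ∀ {m n} → Bool → Graph m → Graph n →
            Fin m ⊎ Fin n → Fin m ⊎ Fin n → Bool
  combAdj b G H (inj₁ x) (inj₁ y) = adj G x y
  combAdj b G H (inj₂ x) (inj₂ y) = adj H x y
  combAdj b G H (inj₁ x) (inj₂ y) = b
  combAdj b G H (inj₂ x) (inj₁ y) = b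

  combSym : ∀ {m n} b (G : Graph m) (H : Graph n) x y →
            combAdj b G H x y ≡ combAdj b G H y x
  combSym b G H (inj₁ x) (inj₁ y) = sym G x y
  combSym b G H (inj₂ x) (inj₂ y) = sym H x y
  combSym b G H (inj₁ x) (inj₂ y) = refl
  combSym b G H (inj₂ x) (inj₁ y) = refl

  combIrr : ∀ {m n} b (G : Graph m) (H : Graph n) x →
            combAdj b G H x x ≡ false
  combIrr b G H (inj₁ x) = irrefl G x
  combIrr b G H (inj₂ x) = irrefl H x

combine : ∀ {m n} → Bool → Graph m → Graph n → Graph (m + n)
combine {m} b G H = record
  { adj    = λ u v → combAdj b G H (splitAt m u) (splitAt m v)
  ; sym    = λ u v → combSym b G H (splitAt m u) (splitAt m v)
  ; irrefl = λ u → combIrr b G H (splitAt m u)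
  }

disjointUnion : ∀ {m n} → Graph m → Graph n → Graph (m + n)
disjointUnion = combine false

completeJoin : ∀ {m n} → Graph m → Graph n → Graph (m + n)
completeJoin = combine true

K1 : Graph 1
K1 = record { adj = λ _ _ → false ; sym = λ _ _ → refl ; irrefl = λ _ → refl }

empty : ∀ n → Graph n
empty n = record { adj = λ _ _ → false ; sym = λ _ _ → refl ; irrefl = λ _ → refl }

completeBipartite : ∀ s t → Graph (s + t)
completeBipartite s t = completeJoin (empty s) (empty t)

data IsCographOn : ∀ {n} → Graph n → Set where
  single : IsCographOn K1
  union  : ∀ {m n} {G : Graph m} {H : Graph n} →
           IsCographOn G → IsCographOn H → IsCographOn (disjointUnion G H)
  join   : ∀ {m n} {G : Graph m} {H : Graph n} →
           IsCographOn G → IsCographOn H → IsCographOn (completeJoin G H)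

IsCograph : ∀ {n} → Graph n → Set
IsCograph {n} G = Σ ℕ λ m → Σ (Graph m) λ H → IsCographOn H × (G ≅ H)

data IsWalk {n} (G : Graph n) : List (Fin n) → Set where
  one  : ∀ v → IsWalk G (v ∷ [])
  step : ∀ {u v vs} → u ∼[ G ] v → IsWalk G (v ∷ vs) → IsWalk G (u ∷ v ∷ vs)

WalkFromTo : ∀ {n} → Graph n → Fin n → Fin n → List (Fin n) → Set
WalkFromTo G u v vs = IsWalk G vs × head vs ≡ just u × last vs ≡ just v

PathFromTo : ∀ {n} → Graph n → Fin n → Fin n → List (Fin n) → Set
PathFromTo G u v vs = WalkFromTo G u v vs × Unique vs

Connected : ∀ {n} → Graph n → Set
Connected {n} G = ∀ (u v : Fin n) → ∃[ vs ] WalkFromTo G u v vs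

HasCycle : ∀ {n} → Graph n → Set
HasCycle {n} G = ∃[ u ] ∃[ v ] ∃[ vs ]
  (PathFromTo G u v vs × 3 ≤ length vs × v ∼[ G ] u)

Acyclic : ∀ {n} → Graph n → Set
Acyclic G = HasCycle G → Data.Empty.⊥
  where import Data.Empty

IsTree : ∀ {n} → Graph n → Set
IsTree G = Connected G × Acyclic G

degree : ∀ {n} → Graph n → Fin n → ℕ
degree {n} G v = sum (map (λ w → if adj G v w then 1 else 0) (allFin n))

IsLeaf : ∀ {n} → Graph n → Fin n → Set
IsLeaf G v = degree G v ≡ 1

data Even : ℕ → Set where
  even0  : Even 0
  even+2 : ∀ {k} → Even k → Even (suc (suc k))

-- For distinct leaves u, v, the (unique) path between them has an even
-- number of edges (= number of vertices − 1).
IsEvenTree : ∀ {n} → Graph n → Set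
IsEvenTree {n} T′ = IsTree T′ ×
  (∀ (u v : Fin n) → IsLeaf T′ u → IsLeaf T′ v → (u ≡ v → Data.Empty.⊥) →
     ∀ vs → PathFromTo T′ u v vs → Even (length vs ∸ 1))
  where import Data.Empty

SpanningSubgraph : ∀ {n} → Graph n → Graph n → Set
SpanningSubgraph {n} T′ G = ∀ (u v : Fin n) → u ∼[ T′ ] v → u ∼[ G ] v

HasSpanningEvenTree : ∀ {n} → Graph n → Set
HasSpanningEvenTree {n} G = ∃[ T′ ] (SpanningSubgraph T′ G × IsEvenTree T′)

module Submission where

-- A connected cograph with at least two vertices is not a disjoint union (that would be
-- disconnected), so it is a join A ⋈ B of two nonempty graphs, say with |A| ≤ |B|.  If |A| < |B|,
-- the zigzag path B₀ A₀ B₁ A₁ ⋯ A₍|A|-1₎ B₍|A|₎ with the remaining vertices of B hung on A₀ is a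
-- spanning tree whose leaves all lie in B; properly 2-colouring it puts B in one colour class,
-- so any two leaves are at even distance.  If |A| = |B| and A has an edge xy, the zigzag runs
-- through A without y and y is hung on x, landing in the colour class of B.  If neither side
-- has an edge, the graph is K_{t,t}.

open import Defs
open import Data.Bool using (Bool; true; false; T; if_then_else_)
open import Data.Bool.Properties using (¬-not; not-injective)
open import Data.Empty using (⊥; ⊥-elim)
open import Data.Fin using (Fin; zero; suc; toℕ; inject≤; fromℕ<; splitAt; punchIn; punchOut)
  renaming (join to joinFin)
open import Data.Fin.Properties
  using (_≟_; any?; toℕ<n; toℕ-inject≤; toℕ-fromℕ<; toℕ-injective; splitAt-join; +↔⊎;
         punchInᵢ≢i; punchIn-punchOut; punchOut-punchIn; punchOut-cong)
open import Data.List using (List; []; _∷_; _++_; _∷ʳ_; length; last; tabulate)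
open import Data.List.Extrema.Nat using (argmax; argmax-sel; f[⊥]≤f[argmax]; f[xs]≤f[argmax])
open import Data.List.Membership.Propositional using (_∈_)
open import Data.List.Membership.Propositional.Properties using (∈-∃++)
open import Data.List.Properties using (++-assoc; ++-identityʳ; length-++-comm; map-tabulate)
open import Data.List.Relation.Unary.All as All using (All; []; _∷_)
import Data.List.Relation.Unary.All.Properties as All
open import Data.List.Relation.Unary.AllPairs using (_∷_)
open import Data.List.Relation.Unary.Any using (here; there)
open import Data.List.Relation.Unary.Unique.Propositional using (Unique)
open import Data.Maybe using (Maybe; just; nothing; is-nothing)
open import Data.Nat using (ℕ; zero; suc; _+_; _∸_; _≤_; _<_; z≤n; s≤s; _≤?_; _<?_)
open import Data.Nat.Induction using (<-wellFounded)
open import Data.Nat.ListAction using (sum)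
open import Data.Nat.Properties
  using (≤-refl; ≤-trans; ≤-reflexive; <-irrefl; <-trans; <⇒≤; <⇒≱; <-cmp; m≤m+n; m≤n+m;
         +-mono-≤; +-suc; n<1+n; m≤n⇒m≤1+n)
open import Data.Product using (∃-syntax; _×_; _,_; proj₁; proj₂)
open import Data.Sum using (_⊎_; inj₁; inj₂; swap; [_,_]′)
open import Data.Sum.Algebra using (⊎-comm)
open import Data.Unit using (⊤; tt)
open import Function using (_∘_)
open import Function.Bundles using (_↔_; Inverse; mk⇔)
open import Function.Properties.Inverse using (↔-sym; ↔-trans)
open import Induction.WellFounded using (Acc; acc; WellFounded)
open import Relation.Binary using (tri<; tri≈; tri>)
import Relation.Binary.Construct.On as On
open import Relation.Binary.PropositionalEquality
  using (_≡_; _≢_; refl; trans; cong; subst; subst₂)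
  renaming (sym to ≡-sym)
open import Relation.Nullary using (¬_; Dec; yes; no; does; contradiction)
open import Relation.Nullary.Decidable using (¬?; _×-dec_; _⊎-dec_; does-⇔; dec-true; dec-false; decidable-stable; T?)

argmax-∈ : ∀ {A : Set} (f : A → ℕ) x xs → argmax f x xs ∈ x ∷ xs
argmax-∈ f x xs with argmax-sel f x xs
... | inj₁ eq = here eq
... | inj₂ m = there m

argmax-maximal : ∀ {A : Set} (f : A → ℕ) x xs → All (λ y → f y ≤ f (argmax f x xs)) (x ∷ xs)
argmax-maximal f x xs = f[⊥]≤f[argmax] {f = f} x xs ∷ f[xs]≤f[argmax] {f = f} x xs

All-rotate : ∀ {A : Set} {P : A → Set} pre {M} post → All P (pre ++ M ∷ post) → All P (post ++ pre)
All-rotate pre post ps with All.++⁻ pre ps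
... | ps₁ , _ ∷ ps₂ = All.++⁺ ps₂ ps₁

last-∈ : ∀ {A : Set} (x : A) xs {y} → last (x ∷ xs) ≡ just y → y ∈ x ∷ xs
last-∈ x [] refl = here refl
last-∈ x (x′ ∷ xs) eq = there (last-∈ x′ xs eq)

module _ {n} {G : Graph n} where

  WalkFromTo-∷ : ∀ {u w v vs} → u ∼[ G ] w → WalkFromTo G w v vs → WalkFromTo G u v (u ∷ vs)
  WalkFromTo-∷ e (W@(one _) , refl , l) = step e W , refl , l
  WalkFromTo-∷ e (W@(step _ _) , refl , l) = step e W , refl , l

  WalkFromTo-∷ʳ : ∀ {u w v vs} → WalkFromTo G u w vs → w ∼[ G ] v → WalkFromTo G u v (vs ∷ʳ v)
  WalkFromTo-∷ʳ (one _ , refl , refl) e = step e (one _) , refl , refl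
  WalkFromTo-∷ʳ (step e′ W , refl , l) e with WalkFromTo-∷ʳ (W , refl , l) e
  ... | W′ , _ , l′ = step e′ W′ , refl , l′

  walk-invariant : ∀ {B : Set} (f : Fin n → B) → (∀ {u v} → u ∼[ G ] v → f u ≡ f v) →
                   ∀ {u v vs} → WalkFromTo G u v vs → f u ≡ f v
  walk-invariant f inv (one _ , refl , refl) = refl
  walk-invariant f inv (step e W , refl , l) = trans (inv e) (walk-invariant f inv (W , refl , l))

  IsCycle : List (Fin n) → Set
  IsCycle vs = ∃[ u ] ∃[ v ] (PathFromTo G u v vs × 3 ≤ length vs × v ∼[ G ] u)

  IsCycle-rotate : ∀ {x xs} → IsCycle (x ∷ xs) → IsCycle (xs ∷ʳ x)
  IsCycle-rotate {xs = []} (_ , _ , _ , s≤s () , _)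
  IsCycle-rotate {x} {y ∷ ys} (_ , _ , ((step e W , refl , l) , U) , len , vx) =
    y , x , (WalkFromTo-∷ʳ (W , refl , l) vx , Unique-rotate U) ,
    subst (3 ≤_) (≡-sym (length-++-comm (y ∷ ys) (x ∷ []))) len , e
    where
    Unique-rotate : ∀ {z zs} → Unique (z ∷ zs) → Unique (zs ∷ʳ z)
    Unique-rotate {zs = []} u = u
    Unique-rotate {zs = _ ∷ _} ((z≢w ∷ z∉) ∷ (w∉ ∷ rest)) =
      All.∷ʳ⁺ w∉ (z≢w ∘ ≡-sym) ∷ Unique-rotate (z∉ ∷ rest)

  IsCycle-rotateTo : ∀ pre {M} post → IsCycle (pre ++ M ∷ post) → IsCycle (M ∷ post ++ pre)
  IsCycle-rotateTo [] post c rewrite ++-identityʳ post = c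
  IsCycle-rotateTo (x ∷ pre) {M} post c =
    subst IsCycle (cong (M ∷_) (++-assoc post (x ∷ []) pre))
      (IsCycle-rotateTo pre (post ∷ʳ x)
        (subst IsCycle (++-assoc pre (M ∷ post) (x ∷ [])) (IsCycle-rotate c)))

degree-≥2 : ∀ {n} (G : Graph n) {u w₁ w₂} → w₁ ≢ w₂ → u ∼[ G ] w₁ → u ∼[ G ] w₂ → 2 ≤ degree G u
degree-≥2 {n} G {u} w₁≢w₂ e₁ e₂
  rewrite map-tabulate {n = n} (λ w → w) (λ w → if adj G u w then 1 else 0) =
  count-≥2 (adj G u) w₁≢w₂ e₁ e₂
  where
  count : ∀ {m} → (Fin m → Bool) → ℕ
  count g = sum (tabulate (λ w → if g w then 1 else 0))

  indicator-T : ∀ {b} → T b → 1 ≤ (if b then 1 else 0)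
  indicator-T {true} _ = ≤-refl

  count-≥1 : ∀ {m} (g : Fin m → Bool) {w} → T (g w) → 1 ≤ count g
  count-≥1 g {zero} t = ≤-trans (indicator-T t) (m≤m+n _ _)
  count-≥1 g {suc w} t = ≤-trans (count-≥1 (g ∘ suc) t) (m≤n+m _ _)

  count-≥2 : ∀ {m} (g : Fin m → Bool) {w₁ w₂} → w₁ ≢ w₂ → T (g w₁) → T (g w₂) → 2 ≤ count g
  count-≥2 g {zero} {zero} ne _ _ = contradiction refl ne
  count-≥2 g {zero} {suc _} _ t₁ t₂ = +-mono-≤ (indicator-T t₁) (count-≥1 (g ∘ suc) t₂)
  count-≥2 g {suc _} {zero} _ t₁ t₂ = +-mono-≤ (indicator-T t₂) (count-≥1 (g ∘ suc) t₁)
  count-≥2 g {suc _} {suc _} ne t₁ t₂ =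
    ≤-trans (count-≥2 (g ∘ suc) (ne ∘ cong suc) t₁ t₂) (m≤n+m _ _)

-- Parent pointers with strictly decreasing rank span a tree.  Colours alternate along its
-- edges and every vertex coloured false has both a parent and a child, so all leaves are
-- coloured true and any two of them are an even distance apart.
record EvenTreeCertificate (X : Set) (E : X → X → Set) : Set where
  field
    root   : X
    parent : X → X
    rank   : X → ℕ
    colour : X → Bool
    parent-rank   : ∀ u → u ≢ root → rank (parent u) < rank u
    parent-edge   : ∀ u → u ≢ root → E u (parent u)
    parent-colour : ∀ u → u ≢ root → colour (parent u) ≢ colour u
    false⇒inner   : ∀ u → colour u ≡ false → u ≢ root × ∃[ w ] (w ≢ root × parent w ≡ u)

module ParentTree {n} {G : Graph n} (C : EvenTreeCertificate (Fin n) (λ u v → u ∼[ G ] v)) where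
  open EvenTreeCertificate C

  Linked : Fin n → Fin n → Set
  Linked u w = (u ≢ root × parent u ≡ w) ⊎ (w ≢ root × parent w ≡ u)

  linked? : ∀ u w → Dec (Linked u w)
  linked? u w = (¬? (u ≟ root) ×-dec parent u ≟ w) ⊎-dec (¬? (w ≟ root) ×-dec parent w ≟ u)

  parent≢ : ∀ u → u ≢ root → parent u ≢ u
  parent≢ u ne e = <-irrefl (cong rank e) (parent-rank u ne)

  ¬Linked-refl : ∀ u → ¬ Linked u u
  ¬Linked-refl u (inj₁ (ne , e)) = parent≢ u ne e
  ¬Linked-refl u (inj₂ (ne , e)) = parent≢ u ne e

  tree : Graph n
  tree = record
    { adj    = λ u w → does (linked? u w)
    ; sym    = λ u w → does-⇔ (mk⇔ swap swap) (linked? u w) (linked? w u)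
    ; irrefl = λ u → dec-false (linked? u u) (¬Linked-refl u)
    }

  Linked⇒adj : ∀ {u w} → Linked u w → u ∼[ tree ] w
  Linked⇒adj {u} {w} l = subst T (≡-sym (dec-true (linked? u w) l)) tt

  adj⇒Linked : ∀ {u w} → u ∼[ tree ] w → Linked u w
  adj⇒Linked {u} {w} t = decidable-stable (linked? u w) (λ ¬l → subst T (dec-false (linked? u w) ¬l) t)

  parent-linked : ∀ {u} → u ≢ root → u ∼[ tree ] parent u
  parent-linked ne = Linked⇒adj (inj₁ (ne , refl))

  child-linked : ∀ {w} → w ≢ root → parent w ∼[ tree ] w
  child-linked ne = Linked⇒adj (inj₂ (ne , refl))

  tree-spanning : SpanningSubgraph tree G
  tree-spanning u w t with adj⇒Linked {u} {w} t
  ... | inj₁ (ne , refl) = parent-edge u ne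
  ... | inj₂ (ne , refl) = subst T (Graph.sym G w u) (parent-edge w ne)

  _≺_ : Fin n → Fin n → Set
  u ≺ w = rank u < rank w

  ≺-wellFounded : WellFounded _≺_
  ≺-wellFounded = On.wellFounded rank <-wellFounded

  walk-to-root : ∀ u → Acc _≺_ u → ∃[ vs ] WalkFromTo tree u root vs
  walk-to-root u (acc rs) with u ≟ root
  ... | yes refl = root ∷ [] , one root , refl , refl
  ... | no ne with walk-to-root (parent u) (rs (parent-rank u ne))
  ...   | vs , W = u ∷ vs , WalkFromTo-∷ (parent-linked ne) W

  walk-via-root : ∀ u v → Acc _≺_ v → ∃[ vs ] WalkFromTo tree u v vs
  walk-via-root u v (acc rs) with v ≟ root
  ... | yes refl = walk-to-root u (≺-wellFounded u)
  ... | no ne with walk-via-root u (parent v) (rs (parent-rank v ne))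
  ...   | vs , W = vs ∷ʳ v , WalkFromTo-∷ʳ W (child-linked ne)

  tree-connected : Connected tree
  tree-connected u v = walk-via-root u v (≺-wellFounded v)

  linked-below : ∀ {M w} → Linked M w → rank w ≤ rank M → parent M ≡ w
  linked-below (inj₁ (_ , e)) _ = e
  linked-below (inj₂ (ne , refl)) le = contradiction le (<⇒≱ (parent-rank _ ne))

  ¬cycle-at-max : ∀ {M zs} → IsCycle {G = tree} (M ∷ zs) → ¬ All (λ w → rank w ≤ rank M) zs
  ¬cycle-at-max {zs = []} (_ , _ , _ , s≤s () , _)
  ¬cycle-at-max {zs = _ ∷ []} (_ , _ , _ , s≤s (s≤s ()) , _)
  ¬cycle-at-max {zs = z ∷ z′ ∷ zs} (_ , v , ((step e _ , refl , l) , _ ∷ (z∉ ∷ _)) , _ , vM)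
                (z≤ ∷ below) =
    All.lookup z∉ v∈ (trans (≡-sym (linked-below (adj⇒Linked e) z≤))
                            (linked-below (swap (adj⇒Linked vM)) (All.lookup below v∈)))
    where
    v∈ : v ∈ z′ ∷ zs
    v∈ = last-∈ z′ zs l

  -- a vertex of maximal rank on a cycle would have both of its cycle neighbours as parent
  tree-acyclic : Acyclic tree
  tree-acyclic (u , v , [] , ((_ , () , _) , _) , _)
  tree-acyclic (u , v , x ∷ xs , c) with ∈-∃++ (argmax-∈ rank x xs)
  ... | pre , post , eq =
    ¬cycle-at-max (IsCycle-rotateTo pre post (subst IsCycle eq (u , v , c)))
                  (All-rotate pre post (subst (All _) eq (argmax-maximal rank x xs)))

  linked-colours : ∀ {u w} → u ∼[ tree ] w → colour u ≢ colour w
  linked-colours {u} {w} t with adj⇒Linked {u} {w} t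
  ... | inj₁ (ne , refl) = parent-colour u ne ∘ ≡-sym
  ... | inj₂ (ne , refl) = parent-colour w ne

  walk-parity : ∀ {x y xs} → WalkFromTo tree x y (x ∷ xs) →
                (colour x ≡ colour y → Even (length xs)) × (colour x ≢ colour y → Even (suc (length xs)))
  walk-parity (one _ , refl , refl) = (λ _ → even0) , (λ ne → contradiction refl ne)
  walk-parity (step e W , refl , l) with walk-parity (W , refl , l)
  ... | same , different =
    (λ x≡y → different (λ x′≡y → linked-colours e (trans x≡y (≡-sym x′≡y)))) ,
    (λ x≢y → even+2 (same (not-injective (trans (≡-sym (¬-not (linked-colours e))) (¬-not x≢y)))))

  parent≢child : ∀ {u w} → u ≢ root → w ≢ root → parent w ≡ u → parent u ≢ w
  parent≢child {u} {w} u≢r w≢r pw≡u pu≡w =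
    <-irrefl refl (<-trans (subst (λ z → rank z < rank u) pu≡w (parent-rank u u≢r))
                           (subst (λ z → rank z < rank w) pw≡u (parent-rank w w≢r)))

  leaf-colour : ∀ u → IsLeaf tree u → colour u ≡ true
  leaf-colour u leaf with colour u in eq
  ... | true = refl
  ... | false with false⇒inner u eq
  ...   | u≢r , w , w≢r , pw≡u =
    contradiction (subst (2 ≤_) leaf (degree-≥2 tree (parent≢child u≢r w≢r pw≡u)
                     (parent-linked u≢r) (Linked⇒adj (inj₂ (w≢r , pw≡u)))))
                  λ { (s≤s ()) }

  tree-even : IsEvenTree tree
  tree-even = (tree-connected , tree-acyclic) , leaves-even
    where
    leaves-even : ∀ u v → IsLeaf tree u → IsLeaf tree v → (u ≡ v → ⊥) →
                  ∀ vs → PathFromTo tree u v vs → Even (length vs ∸ 1)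
    leaves-even u v _ _ _ [] ((_ , () , _) , _)
    leaves-even u v u-leaf v-leaf _ (x ∷ xs) ((W , refl , l) , _) =
      proj₁ (walk-parity (W , refl , l)) (trans (leaf-colour u u-leaf) (≡-sym (leaf-colour v v-leaf)))

certificate⇒spanningEvenTree : ∀ {n} {G : Graph n} → EvenTreeCertificate (Fin n) (λ u v → u ∼[ G ] v) →
                               HasSpanningEvenTree G
certificate⇒spanningEvenTree {G = G} C = tree , tree-spanning , tree-even
  where open ParentTree {G = G} C

subsingleton-certificate : ∀ {X : Set} {E : X → X → Set} (r : X) → (∀ x → x ≡ r) → EvenTreeCertificate X E
subsingleton-certificate r ≡r = record
  { root          = r
  ; parent        = λ x → x
  ; rank          = λ _ → 0
  ; colour        = λ _ → true
  ; parent-rank   = λ x x≢r → contradiction (≡r x) x≢r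
  ; parent-edge   = λ x x≢r → contradiction (≡r x) x≢r
  ; parent-colour = λ x x≢r → contradiction (≡r x) x≢r
  ; false⇒inner   = λ _ ()
  }

transport : ∀ {X Y : Set} {E : X → X → Set} {E′ : Y → Y → Set} (f : X ↔ Y) →
            (∀ {x y} → E x y → E′ (Inverse.to f x) (Inverse.to f y)) →
            EvenTreeCertificate X E → EvenTreeCertificate Y E′
transport {Y = Y} {E′ = E′} f edge C = record
  { root          = to root
  ; parent        = parent′
  ; rank          = rank ∘ from
  ; colour        = colour ∘ from
  ; parent-rank   = λ y y≢r → subst (λ z → rank z < rank (from y)) (≡-sym (strictlyInverseʳ _))
                                    (parent-rank (from y) (from-≢ y≢r))
  ; parent-edge   = λ y y≢r → subst (λ z → E′ z (parent′ y)) (strictlyInverseˡ y)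
                                    (edge (parent-edge (from y) (from-≢ y≢r)))
  ; parent-colour = λ y y≢r → subst (λ z → colour z ≢ colour (from y)) (≡-sym (strictlyInverseʳ _))
                                    (parent-colour (from y) (from-≢ y≢r))
  ; false⇒inner   = false⇒inner′
  }
  where
  open EvenTreeCertificate C
  open Inverse f

  parent′ : Y → Y
  parent′ y = to (parent (from y))

  from-≢ : ∀ {y} → y ≢ to root → from y ≢ root
  from-≢ {y} y≢r e = y≢r (trans (≡-sym (strictlyInverseˡ y)) (cong to e))

  to-≢ : ∀ {x} → x ≢ root → to x ≢ to root
  to-≢ {x} x≢r e = x≢r (trans (≡-sym (strictlyInverseʳ x)) (trans (cong from e) (strictlyInverseʳ root)))

  false⇒inner′ : ∀ y → colour (from y) ≡ false → y ≢ to root × ∃[ w ] (w ≢ to root × parent′ w ≡ y)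
  false⇒inner′ y c with false⇒inner (from y) c
  ... | fy≢r , w , w≢r , pw≡fy =
    (λ e → fy≢r (trans (cong from e) (strictlyInverseʳ root))) ,
    to w , to-≢ w≢r ,
    trans (cong (to ∘ parent) (strictlyInverseʳ w)) (trans (cong to pw≡fy) (strictlyInverseˡ y))

≅-reflects-adj : ∀ {n m} {G : Graph n} {H : Graph m} (iso : G ≅ H) {u v} → u ∼[ H ] v →
                 Inverse.from (_≅_.bij iso) u ∼[ G ] Inverse.from (_≅_.bij iso) v
≅-reflects-adj {H = H} iso {u} {v} e =
  subst T (≡-sym (preserve (from u) (from v)))
    (subst₂ (λ u′ v′ → u′ ∼[ H ] v′) (≡-sym (strictlyInverseˡ u)) (≡-sym (strictlyInverseˡ v)) e)
  where
  open _≅_ iso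
  open Inverse bij

≅-adj-cong : ∀ {n m} {G : Graph n} {H H′ : Graph m} → G ≅ H → (∀ u v → adj H u v ≡ adj H′ u v) → G ≅ H′
≅-adj-cong iso same = record { bij = bij ; preserve = λ u v → trans (preserve u v) (same _ _) }
  where open _≅_ iso

JoinEdge : ∀ {a b} → Graph a → Graph b → Fin a ⊎ Fin b → Fin a ⊎ Fin b → Set
JoinEdge A B (inj₁ x) (inj₁ y) = x ∼[ A ] y
JoinEdge A B (inj₂ x) (inj₂ y) = x ∼[ B ] y
JoinEdge A B _        _        = ⊤

JoinEdge⇒adj : ∀ {a b} {A : Graph a} {B : Graph b} x y → JoinEdge A B x y →
               joinFin a b x ∼[ completeJoin A B ] joinFin a b y
JoinEdge⇒adj {a} {b} x y e rewrite splitAt-join a b x | splitAt-join a b y with x | y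
... | inj₁ _ | inj₁ _ = e
... | inj₁ _ | inj₂ _ = tt
... | inj₂ _ | inj₁ _ = tt
... | inj₂ _ | inj₂ _ = e

JoinEdge-swap : ∀ {a b} {A : Graph a} {B : Graph b} x y → JoinEdge B A x y → JoinEdge A B (swap x) (swap y)
JoinEdge-swap (inj₁ _) (inj₁ _) e = e
JoinEdge-swap (inj₁ _) (inj₂ _) _ = tt
JoinEdge-swap (inj₂ _) (inj₁ _) _ = tt
JoinEdge-swap (inj₂ _) (inj₂ _) e = e

certificate-swap : ∀ {a b} {A : Graph a} {B : Graph b} →
                   EvenTreeCertificate (Fin b ⊎ Fin a) (JoinEdge B A) →
                   EvenTreeCertificate (Fin a ⊎ Fin b) (JoinEdge A B)
certificate-swap = transport (⊎-comm _ _) (λ {x} {y} → JoinEdge-swap x y)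

join-certificate⇒spanningEvenTree : ∀ {n a b} {G : Graph n} {A : Graph a} {B : Graph b} →
  G ≅ completeJoin A B → EvenTreeCertificate (Fin a ⊎ Fin b) (JoinEdge A B) → HasSpanningEvenTree G
join-certificate⇒spanningEvenTree {G = G} iso C = certificate⇒spanningEvenTree {G = G}
  (transport (↔-trans (↔-sym +↔⊎) (↔-sym (_≅_.bij iso)))
             (λ {x} {y} e → ≅-reflects-adj iso (JoinEdge⇒adj x y e)) C)

-- The tree is the path B₀ A₀ B₁ A₁ ⋯ A₍ₛ₋₁₎ Bₛ, where Aₖ = spine k and Bⱼ is vertex j of B,
-- with every other vertex of A and of B hanging from A_hub.
module Caterpillar {a b s : ℕ} (A : Graph a) (B : Graph (suc b)) (s≤b : s ≤ b)
  (spine : Fin s → Fin a) (spine⁻¹ : Fin a → Maybe (Fin s))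
  (spine⁻¹-spine : ∀ k → spine⁻¹ (spine k) ≡ just k)
  (spine-spine⁻¹ : ∀ {i k} → spine⁻¹ i ≡ just k → spine k ≡ i)
  (hub : Fin s) (hub-adjacent : ∀ {i} → spine⁻¹ i ≡ nothing → i ∼[ A ] spine hub) where

  X : Set
  X = Fin a ⊎ Fin (suc b)

  root : X
  root = inj₂ zero

  B-before : Fin s → Fin (suc b)
  B-before k = inject≤ k (m≤n⇒m≤1+n s≤b)

  B-after : Fin s → Fin (suc b)
  B-after k = suc (inject≤ k s≤b)

  A-before : Fin b → Fin a
  A-before m with toℕ m <? s
  ... | yes m<s = spine (fromℕ< m<s)
  ... | no _    = spine hub

  parentA : Maybe (Fin s) → X
  parentA (just k) = inj₂ (B-before k)
  parentA nothing  = inj₁ (spine hub)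

  parent : X → X
  parent (inj₁ i)       = parentA (spine⁻¹ i)
  parent (inj₂ zero)    = root
  parent (inj₂ (suc m)) = inj₁ (A-before m)

  pendant-rank : ℕ
  pendant-rank = suc (suc (toℕ hub + toℕ hub))

  rankA : Maybe (Fin s) → ℕ
  rankA (just k) = suc (toℕ k + toℕ k)
  rankA nothing  = pendant-rank

  rankB : ℕ → ℕ
  rankB j with j ≤? s
  ... | yes _ = j + j
  ... | no _  = pendant-rank

  rank : X → ℕ
  rank (inj₁ i) = rankA (spine⁻¹ i)
  rank (inj₂ j) = rankB (toℕ j)

  colour : X → Bool
  colour (inj₁ i) = is-nothing (spine⁻¹ i)
  colour (inj₂ _) = true

  rankB-path : ∀ {j} → j ≤ s → rankB j ≡ j + j
  rankB-path {j} j≤s with j ≤? s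
  ... | yes _   = refl
  ... | no j≰s  = contradiction j≤s j≰s

  rank-spine : ∀ k → rank (inj₁ (spine k)) ≡ suc (toℕ k + toℕ k)
  rank-spine k rewrite spine⁻¹-spine k = refl

  colour-spine : ∀ k → colour (inj₁ (spine k)) ≡ false
  colour-spine k rewrite spine⁻¹-spine k = refl

  colour-A-before : ∀ m → colour (inj₁ (A-before m)) ≡ false
  colour-A-before m with toℕ m <? s
  ... | yes m<s = colour-spine (fromℕ< m<s)
  ... | no _    = colour-spine hub

  A-before-B-after : ∀ k → A-before (inject≤ k s≤b) ≡ spine k
  A-before-B-after k with toℕ (inject≤ k s≤b) <? s
  ... | yes k<s = cong spine (toℕ-injective (trans (toℕ-fromℕ< k<s) (toℕ-inject≤ k s≤b)))
  ... | no k≮s  = contradiction (subst (_< s) (≡-sym (toℕ-inject≤ k s≤b)) (toℕ<n k)) k≮s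

  parentA-rank : ∀ k? → rank (parentA k?) < rankA k?
  parentA-rank (just k)
    rewrite toℕ-inject≤ k (m≤n⇒m≤1+n s≤b) | rankB-path (<⇒≤ (toℕ<n k)) = n<1+n _
  parentA-rank nothing rewrite rank-spine hub = n<1+n _

  -- m < s unfolds to suc m ≤ s, so this with also evaluates rankB (suc m).
  A-before-rank : ∀ m → rank (inj₁ (A-before m)) < rankB (suc (toℕ m))
  A-before-rank m with toℕ m <? s
  ... | yes m<s rewrite rank-spine (fromℕ< m<s) | toℕ-fromℕ< m<s =
    s≤s (≤-reflexive (≡-sym (+-suc (toℕ m) (toℕ m))))
  ... | no m≮s rewrite rank-spine hub = n<1+n _

  parent-rank : ∀ u → u ≢ root → rank (parent u) < rank u
  parent-rank (inj₁ i)       _    = parentA-rank (spine⁻¹ i)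
  parent-rank (inj₂ zero)    u≢r = contradiction refl u≢r
  parent-rank (inj₂ (suc m)) _    = A-before-rank m

  parent-edge : ∀ u → u ≢ root → JoinEdge A B u (parent u)
  parent-edge (inj₁ i) _ with spine⁻¹ i in eq
  ... | just _  = tt
  ... | nothing = hub-adjacent eq
  parent-edge (inj₂ zero)    u≢r = contradiction refl u≢r
  parent-edge (inj₂ (suc _)) _    = tt

  parent-colour : ∀ u → u ≢ root → colour (parent u) ≢ colour u
  parent-colour (inj₁ i) _ with spine⁻¹ i
  ... | just _  = λ ()
  ... | nothing rewrite colour-spine hub = λ ()
  parent-colour (inj₂ zero)    u≢r = contradiction refl u≢r
  parent-colour (inj₂ (suc m)) _ rewrite colour-A-before m = λ ()

  false⇒inner : ∀ u → colour u ≡ false → u ≢ root × ∃[ w ] (w ≢ root × parent w ≡ u)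
  false⇒inner (inj₁ i) c with spine⁻¹ i in eq
  ... | just k  = (λ ()) , inj₂ (B-after k) , (λ ()) ,
                  cong inj₁ (trans (A-before-B-after k) (spine-spine⁻¹ eq))
  ... | nothing = contradiction c λ ()
  false⇒inner (inj₂ _) ()

  certificate : EvenTreeCertificate X (JoinEdge A B)
  certificate = record
    { root = root ; parent = parent ; rank = rank ; colour = colour
    ; parent-rank = parent-rank ; parent-edge = parent-edge
    ; parent-colour = parent-colour ; false⇒inner = false⇒inner
    }

join-certificate-< : ∀ {a b} (A : Graph (suc a)) (B : Graph (suc b)) → suc a ≤ b →
                     EvenTreeCertificate (Fin (suc a) ⊎ Fin (suc b)) (JoinEdge A B)
join-certificate-< A B a<b =
  Caterpillar.certificate A B a<b (λ i → i) just (λ _ → refl) (λ { refl → refl }) zero (λ ())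

-- When |A| = |B| the path cannot use all of A, so y is left off it and hung on its neighbour x.
join-certificate-edge : ∀ {s b} (A : Graph (suc s)) (B : Graph (suc b)) → s ≤ b → ∀ {x y} → x ∼[ A ] y →
                        EvenTreeCertificate (Fin (suc s) ⊎ Fin (suc b)) (JoinEdge A B)
join-certificate-edge A B s≤b {x} {y} x∼y =
  Caterpillar.certificate A B s≤b (punchIn y) spine⁻¹ spine⁻¹-spine spine-spine⁻¹ (punchOut y≢x) y-adjacent
  where
  y≢x : y ≢ x
  y≢x refl = subst T (irrefl A y) x∼y

  spine⁻¹ : Fin (suc _) → Maybe (Fin _)
  spine⁻¹ i with y ≟ i
  ... | yes _   = nothing
  ... | no y≢i  = just (punchOut y≢i)

  spine⁻¹-spine : ∀ k → spine⁻¹ (punchIn y k) ≡ just k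
  spine⁻¹-spine k with y ≟ punchIn y k
  ... | yes y≡ = contradiction (≡-sym y≡) (punchInᵢ≢i y k)
  ... | no _   = cong just (trans (punchOut-cong y refl) (punchOut-punchIn y))

  spine-spine⁻¹ : ∀ {i k} → spine⁻¹ i ≡ just k → punchIn y k ≡ i
  spine-spine⁻¹ {i} eq with y ≟ i
  spine-spine⁻¹ {i} ()   | yes _
  spine-spine⁻¹ {i} refl | no y≢i = punchIn-punchOut y≢i

  y-adjacent : ∀ {i} → spine⁻¹ i ≡ nothing → i ∼[ A ] punchIn y (punchOut y≢x)
  y-adjacent {i} eq with y ≟ i
  y-adjacent {i} eq   | yes refl rewrite punchIn-punchOut y≢x = subst T (Graph.sym A x y) x∼y
  y-adjacent {i} ()   | no _

Edgeless : ∀ {a} → Graph a → Set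
Edgeless A = ∀ x y → adj A x y ≡ false

edge-or-edgeless : ∀ {a} (A : Graph a) → (∃[ x ] ∃[ y ] x ∼[ A ] y) ⊎ Edgeless A
edge-or-edgeless A with any? (λ x → any? (λ y → T? (adj A x y)))
... | yes (x , y , x∼y) = inj₁ (x , y , x∼y)
... | no none           = inj₂ λ x y → dec-false (T? (adj A x y)) (λ x∼y → none (x , y , x∼y))

completeJoin-edgeless : ∀ {a b} {A : Graph a} {B : Graph b} → Edgeless A → Edgeless B →
                        ∀ u v → adj (completeJoin A B) u v ≡ adj (completeBipartite a b) u v
completeJoin-edgeless {a} noA noB u v with splitAt a u | splitAt a v
... | inj₁ x | inj₁ y = noA x y
... | inj₁ _ | inj₂ _ = refl
... | inj₂ _ | inj₁ _ = refl
... | inj₂ x | inj₂ y = noB x y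

join-spanningEvenTree : ∀ {n a b} {G : Graph n} {A : Graph a} {B : Graph b} → 1 ≤ a → 1 ≤ b →
  G ≅ completeJoin A B → ¬ (∃[ t ] (1 ≤ t × G ≅ completeBipartite t t)) → HasSpanningEvenTree G
join-spanningEvenTree {a = suc a} {suc b} {A = A} {B} (s≤s z≤n) (s≤s z≤n) iso ¬Kₜₜ with <-cmp a b
... | tri< a<b _ _ = join-certificate⇒spanningEvenTree iso (join-certificate-< A B a<b)
... | tri> _ _ b<a = join-certificate⇒spanningEvenTree iso (certificate-swap (join-certificate-< B A b<a))
... | tri≈ _ refl _ with edge-or-edgeless A | edge-or-edgeless B
...   | inj₁ (_ , _ , x∼y) | _ =
  join-certificate⇒spanningEvenTree iso (join-certificate-edge A B ≤-refl x∼y)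
...   | inj₂ _ | inj₁ (_ , _ , x∼y) =
  join-certificate⇒spanningEvenTree iso (certificate-swap (join-certificate-edge B A ≤-refl x∼y))
...   | inj₂ noA | inj₂ noB =
  contradiction (suc a , s≤s z≤n , ≅-adj-cong iso (completeJoin-edgeless noA noB)) ¬Kₜₜ

onLeft : ∀ {A B : Set} → A ⊎ B → Bool
onLeft = [ (λ _ → true) , (λ _ → false) ]′

disjointUnion-sides : ∀ {a b} {A : Graph a} {B : Graph b} {u v} → u ∼[ disjointUnion A B ] v →
                      onLeft (splitAt a u) ≡ onLeft (splitAt a v)
disjointUnion-sides {a} {u = u} {v} e with splitAt a u | splitAt a v
... | inj₁ _ | inj₁ _ = refl
... | inj₂ _ | inj₂ _ = refl

disjointUnion-disconnected : ∀ {n a b} {G : Graph n} {A : Graph a} {B : Graph b} → 1 ≤ a → 1 ≤ b →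
                             G ≅ disjointUnion A B → ¬ Connected G
disjointUnion-disconnected {a = a} {b} {G} {A} {B} (s≤s z≤n) (s≤s z≤n) iso connected =
  contradiction (trans (≡-sym (side-vertex (inj₁ zero)))
                 (trans (walk-invariant side side-preserved (proj₂ (connected _ _)))
                        (side-vertex (inj₂ zero))))
                λ ()
  where
  open _≅_ iso
  open Inverse bij

  side : Fin _ → Bool
  side u = onLeft (splitAt a (to u))

  side-preserved : ∀ {u v} → u ∼[ G ] v → side u ≡ side v
  side-preserved {u} {v} e = disjointUnion-sides {A = A} {B} {to u} {to v} (subst T (preserve u v) e)

  side-vertex : ∀ x → side (from (joinFin a b x)) ≡ onLeft x
  side-vertex x = cong onLeft (trans (cong (splitAt a) (strictlyInverseˡ _)) (splitAt-join a b x))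

cograph-nonempty : ∀ {m} {H : Graph m} → IsCographOn H → 1 ≤ m
cograph-nonempty single              = ≤-refl
cograph-nonempty (union {m} {n} c _) = ≤-trans (cograph-nonempty c) (m≤m+n m n)
cograph-nonempty (join {m} {n} c _)  = ≤-trans (cograph-nonempty c) (m≤m+n m n)

singleVertex-spanningEvenTree : ∀ {n} {G : Graph n} → G ≅ K1 → HasSpanningEvenTree G
singleVertex-spanningEvenTree {G = G} iso = certificate⇒spanningEvenTree {G = G}
  (subsingleton-certificate (from zero) λ u → trans (≡-sym (strictlyInverseʳ u)) (cong from (Fin1 (to u))))
  where
  open Inverse (_≅_.bij iso)
  Fin1 : ∀ (i : Fin 1) → i ≡ zero
  Fin1 zero = refl

theorem5 : ∀ {n} (G : Graph n) → IsCograph G → Connected G →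
    ¬ (∃[ t ] (1 ≤ t × G ≅ completeBipartite t t)) →
    HasSpanningEvenTree G
theorem5 G (_ , _ , single , iso) _ _ = singleVertex-spanningEvenTree iso
theorem5 G (_ , _ , union cA cB , iso) connected _ =
  ⊥-elim (disjointUnion-disconnected (cograph-nonempty cA) (cograph-nonempty cB) iso connected)
theorem5 G (_ , _ , join cA cB , iso) _ ¬Kₜₜ =
  join-spanningEvenTree (cograph-nonempty cA) (cograph-nonempty cB) iso ¬Kₜₜ
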